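{- For all positive integers $n$ and $s$, $$\frac{n^s}{\Phi_s(n^s)}=\sum_{d\mid n}\frac{\mu(d)^2}{\Phi_s(d^s)},$$ where the sum runs over the positive divisors $d$ of $n$.
   Context: $\mu$ is the Möbius function. For a positive integer $s$ and integers $a,b$ not both zero, $(a,b)_s$ denotes the largest $l^s$ with $l\in\mathbb{N}$ dividing both $a$ and $b$. For positive integers $s,m$, Klee's function $\Phi_s(m)$ is the number of integers $k$ with $1\le k\le m$ and $(k,m)_s=1$. -}

module Defs where

open import Data.Nat using (ℕ; zero; suc; _^_; _⊔_; _≟_; _≤?_)
open import Data.Nat.Divisibility using (_∣_; _∣?_)
open import Data.Nat.Primality using (Prime; prime?)
open import Data.Integer using (ℤ; +_; -_)
open import Data.Rational using (ℚ; 0ℚ; _/_)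
open import Data.List using (List; []; _∷_; filter; length; foldr; map)
open import Data.List.Base using (upTo)
open import Data.Bool using (if_then_else_)
open import Data.Product using (_×_)
open import Relation.Nullary using (Dec; yes; no; ¬_)
open import Relation.Nullary.Decidable using (_×-dec_; ¬?; does)
open import Data.List.Relation.Unary.Any using (any?)

range1 : ℕ → List ℕ
range1 n = map suc (upTo n)

-- (a , b)_s for positive naturals a, b: the largest l^s (l ∈ ℕ, l ≥ 1) dividing
-- both a and b.  Any such l satisfies l ≤ l^s ≤ a, so searching l ∈ [1 .. a + b]
-- is exhaustive.
gcdPow : ℕ → ℕ → ℕ → ℕ
gcdPow s a b =
  foldr _⊔_ 0
    (map (λ l → l ^ s)
      (filter (λ l → ((l ^ s) ∣? a) ×-dec ((l ^ s) ∣? b)) (range1 (a Data.Nat.+ b))))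

Φ : ℕ → ℕ → ℕ
Φ s m = length (filter (λ k → gcdPow s k m ≟ 1) (range1 m))

hasSquareFactor? : (n : ℕ) → Dec _
hasSquareFactor? n = any? (λ k → (k Data.Nat.* k) ∣? n) (map (λ i → suc (suc i)) (upTo n))

ω : ℕ → ℕ
ω n = length (filter (λ p → prime? p ×-dec (p ∣? n)) (range1 n))

μ : ℕ → ℤ
μ n = if does (hasSquareFactor? n) then + 0 else (Data.Integer._^_ (- (+ 1)) (ω n))

-- rational division a / b with the convention x / 0 = 0 (only used with b ≥ 1)
_//_ : ℤ → ℕ → ℚ
a // zero = 0ℚ
a // suc b = a / suc b

divisors : ℕ → List ℕ
divisors n = filter (λ d → d ∣? n) (range1 n)

Σℚ : List ℚ → ℚ
Σℚ = foldr Data.Rational._+_ 0ℚ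

-- Sieving 1 … n^s by the pairwise coprime moduli p^s (p a prime divisor of n), each of which
-- divides n^s, gives Klee's product formula Φ_s(n^s) = n^s ∏_{p ∣ n} (1 − p^(−s)).  Hence passing
-- from m to n = p^(a+1) m with p ∤ m multiplies the left-hand side by p^s / (p^s − 1) = 1 + 1/(p^s − 1).
-- The right-hand side gets the same factor: the divisors of n prime to p are those of m, and the
-- remaining divisors d with μ(d) ≠ 0 are p j with j ∣ m, p ∤ j, where Φ_s((p j)^s) = (p^s − 1) Φ_s(j^s).
module Submission where

open import Algebra.Bundles using (CommutativeSemigroup)
import Algebra.Properties.CommutativeSemigroup as CommutativeSemigroupProperties
open import Algebra.Structures using (IsCommutativeMonoid)
open import Data.Bool using (Bool; true; false; not; _∧_; if_then_else_)
open import Data.Bool.Properties using (if-float; if-eta)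
import Data.Integer as ℤ
open import Data.Integer.Properties using (pos-*)
import Data.Integer.Properties as ℤ
import Data.Integer.Tactic.RingSolver as ℤSolver
open import Data.List using (List; []; _∷_; _++_; [_]; map; foldr; filter; length; upTo)
open import Data.List.Membership.Propositional using (_∈_)
open import Data.List.Membership.Propositional.Properties using (∈-map⁺; ∈-upTo⁺; ∈-filter⁺; ∈-filter⁻)
open import Data.List.Properties using (map-++; upTo-∷ʳ)
open import Data.List.Relation.Unary.All as All using (All; []; _∷_; all?)
open import Data.List.Relation.Unary.All.Properties as All using (all-filter)
open import Data.List.Relation.Unary.AllPairs using (AllPairs; []; _∷_)
open import Data.List.Relation.Unary.Any as Any using (Any; here; there)
import Data.List.Relation.Unary.Any.Properties as Any
open import Data.List.Relation.Unary.Unique.Propositional using (Unique)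
import Data.List.Relation.Unary.Unique.Propositional.Properties as Unique
open import Data.Nat using (ℕ; zero; suc; pred; _+_; _*_; _∸_; _^_; _⊔_; _≤_; _<_; _≟_; z≤n; s≤s)
open import Data.Nat using (NonZero; >-nonZero; >-nonZero⁻¹; ≢-nonZero⁻¹; nonTrivial⇒n>1; nonTrivial⇒≢1)
open import Data.Nat.Coprimality as Coprime using (Coprime; coprime-divisor)
open import Data.Nat.Divisibility
open import Data.Nat.Induction using (<-rec)
open import Data.Nat.ListAction using (product)
open import Data.Nat.Primality using (Prime; prime?; prime⇒nonTrivial; prime⇒nonZero; prime⇒irreducible; euclidsLemma)
open import Data.Nat.Primality.Factorisation using (factorise)
open import Data.Nat.Properties
import Data.Nat.Properties as ℕ
open import Data.Nat.Tactic.RingSolver using (solve-∀)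
open import Data.Product using (∃-syntax; _×_; _,_; proj₁; proj₂)
import Data.Rational as ℚ
open import Data.Rational using (ℚ; 0ℚ; 1ℚ; fromℚᵘ)
import Data.Rational.Properties as ℚ
open import Data.Rational.Properties using (toℚᵘ-injective; toℚᵘ-homo-*; toℚᵘ-homo-+; toℚᵘ-fromℚᵘ; fromℚᵘ-cong)
import Data.Rational.Unnormalised as ℚᵘ
import Data.Rational.Unnormalised.Properties as ℚᵘ
open import Data.Rational.Unnormalised using (mkℚᵘ; *≡*)
open import Data.Sum using (inj₁; inj₂)
open import Defs
open import Function using (_∘_; _⟨_⟩_)
open import Function.Bundles using (_⇔_; mk⇔; module Equivalence)
open import Function.Construct.Composition using (_⇔-∘_)
open import Function.Construct.Symmetry using (⇔-sym)
open import Level using (0ℓ)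
open import Relation.Binary.PropositionalEquality hiding ([_])
open import Relation.Nullary using (Dec; yes; no; does; ¬_; ¬?; contradiction)
open import Relation.Nullary.Decidable using (_×-dec_; dec-true; dec-false; does-⇔)
open import Relation.Unary using (Pred; Decidable)
open ≡-Reasoning

module RangeSum
  {A : Set} {_∙_ : A → A → A} {ε : A}
  (isCommutativeMonoid : IsCommutativeMonoid _≡_ _∙_ ε) where

  open IsCommutativeMonoid isCommutativeMonoid using (assoc; identityˡ; identityʳ; isCommutativeSemigroup)

  commutativeSemigroup : CommutativeSemigroup 0ℓ 0ℓ
  commutativeSemigroup = record { isCommutativeSemigroup = isCommutativeSemigroup }

  open CommutativeSemigroupProperties commutativeSemigroup using (interchange)

  sumTo : (ℕ → A) → ℕ → A
  sumTo f zero    = ε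
  sumTo f (suc n) = sumTo f n ∙ f (suc n)

  foldr-++ : ∀ xs ys → foldr _∙_ ε (xs ++ ys) ≡ foldr _∙_ ε xs ∙ foldr _∙_ ε ys
  foldr-++ []       ys = sym (identityˡ _)
  foldr-++ (x ∷ xs) ys = trans (cong (x ∙_) (foldr-++ xs ys)) (sym (assoc x _ _))

  foldr-map-range1 : ∀ (f : ℕ → A) n → foldr _∙_ ε (map f (range1 n)) ≡ sumTo f n
  foldr-map-range1 f zero    = refl
  foldr-map-range1 f (suc n) = begin
    foldr _∙_ ε (map f (range1 (suc n)))          ≡⟨ cong (foldr _∙_ ε ∘ map f) (range1-suc n) ⟩
    foldr _∙_ ε (map f (range1 n ++ [ suc n ]))   ≡⟨ cong (foldr _∙_ ε) (map-++ f (range1 n) [ suc n ]) ⟩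
    foldr _∙_ ε (map f (range1 n) ++ [ f (suc n) ]) ≡⟨ foldr-++ (map f (range1 n)) _ ⟩
    foldr _∙_ ε (map f (range1 n)) ∙ (f (suc n) ∙ ε) ≡⟨ cong₂ _∙_ (foldr-map-range1 f n) (identityʳ _) ⟩
    sumTo f (suc n)                                ∎
    where
    range1-suc : ∀ n → range1 (suc n) ≡ range1 n ++ [ suc n ]
    range1-suc n = trans (cong (map suc) (sym (upTo-∷ʳ n))) (map-++ suc (upTo n) [ n ])

  foldr-map-filter : ∀ {P : Pred ℕ 0ℓ} (P? : Decidable P) (f : ℕ → A) xs →
    foldr _∙_ ε (map f (filter P? xs)) ≡ foldr _∙_ ε (map (λ x → if does (P? x) then f x else ε) xs)
  foldr-map-filter P? f []       = refl
  foldr-map-filter P? f (x ∷ xs) with does (P? x)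
  ... | true  = cong (f x ∙_) (foldr-map-filter P? f xs)
  ... | false = trans (foldr-map-filter P? f xs) (sym (identityˡ _))

  sumTo-cong : ∀ {f g : ℕ → A} n → (∀ k → 1 ≤ k → k ≤ n → f k ≡ g k) → sumTo f n ≡ sumTo g n
  sumTo-cong zero    f≗g = refl
  sumTo-cong (suc n) f≗g =
    cong₂ _∙_ (sumTo-cong n λ k 1≤k k≤n → f≗g k 1≤k (m≤n⇒m≤1+n k≤n)) (f≗g (suc n) (s≤s z≤n) ≤-refl)

  sumTo-ε : ∀ {f : ℕ → A} n → (∀ k → 1 ≤ k → k ≤ n → f k ≡ ε) → sumTo f n ≡ ε
  sumTo-ε n f≗ε = sumTo-cong n f≗ε ⟨ trans ⟩ sumTo-const-ε n
    where
    sumTo-const-ε : ∀ n → sumTo (λ _ → ε) n ≡ ε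
    sumTo-const-ε zero    = refl
    sumTo-const-ε (suc n) = trans (identityʳ _) (sumTo-const-ε n)

  sumTo-∙ : ∀ (f g : ℕ → A) n → sumTo (λ k → f k ∙ g k) n ≡ sumTo f n ∙ sumTo g n
  sumTo-∙ f g zero    = sym (identityˡ ε)
  sumTo-∙ f g (suc n) = trans (cong (_∙ (f (suc n) ∙ g (suc n))) (sumTo-∙ f g n)) (interchange _ _ _ _)

  sumTo-+ : ∀ (f : ℕ → A) m n → sumTo f (m + n) ≡ sumTo f m ∙ sumTo (λ i → f (m + i)) n
  sumTo-+ f m zero    = trans (cong (sumTo f) (+-identityʳ m)) (sym (identityʳ _))
  sumTo-+ f m (suc n) = begin
    sumTo f (m + suc n)                                 ≡⟨ cong (sumTo f) (+-suc m n) ⟩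
    sumTo f (m + n) ∙ f (suc (m + n))                   ≡⟨ cong₂ _∙_ (sumTo-+ f m n) (cong f (sym (+-suc m n))) ⟩
    (sumTo f m ∙ sumTo (λ i → f (m + i)) n) ∙ f (m + suc n) ≡⟨ assoc _ _ _ ⟩
    sumTo f m ∙ sumTo (λ i → f (m + i)) (suc n)         ∎

  sumTo-extend : ∀ (f : ℕ → A) {m n} → (∀ k → m < k → f k ≡ ε) → m ≤ n → sumTo f n ≡ sumTo f m
  sumTo-extend f {m} {n} h m≤n = begin
    sumTo f n                                  ≡⟨ cong (sumTo f) (sym (m+[n∸m]≡n m≤n)) ⟩
    sumTo f (m + (n ∸ m))                      ≡⟨ sumTo-+ f m (n ∸ m) ⟩
    sumTo f m ∙ sumTo (λ i → f (m + i)) (n ∸ m)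
      ≡⟨ cong (sumTo f m ∙_) (sumTo-ε (n ∸ m) λ i 1≤i _ → h (m + i) (m<m+n m 1≤i)) ⟩
    sumTo f m ∙ ε                              ≡⟨ identityʳ _ ⟩
    sumTo f m                                  ∎

  sumTo-multiples : ∀ (f : ℕ → A) c .{{_ : NonZero c}} t →
    sumTo (λ k → if does (c ∣? k) then f k else ε) (c * t) ≡ sumTo (λ j → f (c * j)) t
  sumTo-multiples f c zero    = cong (sumTo _) (*-zeroʳ c)
  sumTo-multiples f c@(suc c-1) (suc t) = begin
    sumTo g (c * suc t)                                       ≡⟨ cong (sumTo g) (*-suc c t ⟨ trans ⟩ +-comm c (c * t)) ⟩
    sumTo g (c * t + c)                                       ≡⟨ sumTo-+ g (c * t) c ⟩
    sumTo g (c * t) ∙ (sumTo (λ i → g (c * t + i)) c-1 ∙ g (c * t + c))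
      ≡⟨ cong₂ (λ x y → x ∙ (y ∙ g (c * t + c))) (sumTo-multiples f c t) (sumTo-ε c-1 λ i 1≤i i<c → between i 1≤i i<c) ⟩
    sumTo (λ j → f (c * j)) t ∙ (ε ∙ g (c * t + c))
      ≡⟨ cong (sumTo (λ j → f (c * j)) t ∙_) (identityˡ _ ⟨ trans ⟩ atMultiple) ⟩
    sumTo (λ j → f (c * j)) (suc t)                           ∎
    where
    g : ℕ → A
    g k = if does (c ∣? k) then f k else ε
    c*t+c≡c*[1+t] : c * t + c ≡ c * suc t
    c*t+c≡c*[1+t] = +-comm (c * t) c ⟨ trans ⟩ sym (*-suc c t)
    between : ∀ i → 1 ≤ i → i ≤ c-1 → g (c * t + i) ≡ ε
    between i 1≤i i<c = cong (if_then f (c * t + i) else ε) (dec-false (c ∣? (c * t + i))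
      λ c∣ → <⇒≱ (s≤s i<c) (∣⇒≤ {{>-nonZero 1≤i}} (∣m+n∣m⇒∣n c∣ (m∣m*n t))))
    atMultiple : g (c * t + c) ≡ f (c * suc t)
    atMultiple = cong (if_then f (c * t + c) else ε) (dec-true (c ∣? (c * t + c)) (subst (c ∣_) (sym c*t+c≡c*[1+t]) (m∣m*n (suc t))))
                 ⟨ trans ⟩ cong f c*t+c≡c*[1+t]

  sumTo-homo : ∀ (h : A → A) → h ε ≡ ε → (∀ x y → h (x ∙ y) ≡ h x ∙ h y) →
    ∀ (f : ℕ → A) n → sumTo (h ∘ f) n ≡ h (sumTo f n)
  sumTo-homo h h-ε h-∙ f zero    = sym h-ε
  sumTo-homo h h-ε h-∙ f (suc n) = trans (cong (_∙ h (f (suc n))) (sumTo-homo h h-ε h-∙ f n)) (sym (h-∙ _ _))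

^-mono-∣ : ∀ {m n} k → m ∣ n → m ^ k ∣ n ^ k
^-mono-∣ zero    m∣n = ∣-refl
^-mono-∣ (suc k) m∣n = *-pres-∣ m∣n (^-mono-∣ k m∣n)

m∣m^n : ∀ m {n} → 1 ≤ n → m ∣ m ^ n
m∣m^n m {suc n} _ = m∣m*n (m ^ n)

0^n≡0 : ∀ {n} → 1 ≤ n → 0 ^ n ≡ 0
0^n≡0 {suc n} _ = refl

m≤m^n : ∀ {m n} → 1 ≤ m → 1 ≤ n → m ≤ m ^ n
m≤m^n {m} {n} 1≤m 1≤n = subst (_≤ m ^ n) (^-identityʳ m) (^-monoʳ-≤ m {{>-nonZero 1≤m}} 1≤n)

^-distribʳ-* : ∀ m n k → (m * n) ^ k ≡ m ^ k * n ^ k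
^-distribʳ-* m n zero    = refl
^-distribʳ-* m n (suc k) = trans (cong (m * n *_) (^-distribʳ-* m n k)) (x*y*[z*w]≡x*z*[y*w] m n (m ^ k) (n ^ k))
  where
  x*y*[z*w]≡x*z*[y*w] : ∀ x y z w → x * y * (z * w) ≡ x * z * (y * w)
  x*y*[z*w]≡x*z*[y*w] = solve-∀

product≥1 : ∀ {xs} → All (1 ≤_) xs → 1 ≤ product xs
product≥1 []           = ≤-refl
product≥1 (1≤x ∷ 1≤xs) = *-mono-≤ 1≤x (product≥1 1≤xs)

module ℕΣ = RangeSum ℕ.+-0-isCommutativeMonoid

indicator : Bool → ℕ
indicator b = if b then 1 else 0

Free : List ℕ → ℕ → Set
Free T k = All (λ t → ¬ t ∣ k) T

free? : ∀ T k → Dec (Free T k)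
free? T k = all? (λ t → ¬? (t ∣? k)) T

countFree : List ℕ → ℕ → ℕ
countFree T = ℕΣ.sumTo (λ k → indicator (does (free? T k)))

free-*ˡ : ∀ {t T} j → All (λ u → Coprime u t) T → Free T (t * j) ⇔ Free T j
free-*ˡ {t} j coprime = mk⇔
  (λ free → All.zipWith (λ (u⊥t , u∤tj) u∣j → u∤tj (∣n⇒∣m*n t u∣j)) (coprime , free))
  (λ free → All.zipWith (λ (u⊥t , u∤j) u∣tj → u∤j (coprime-divisor u⊥t u∣tj)) (coprime , free))

countFree-∷ : ∀ t T M .{{_ : NonZero t}} → All (λ u → Coprime u t) T →
  countFree T (t * M) ≡ countFree (t ∷ T) (t * M) + countFree T M
countFree-∷ t T M coprime = begin
  countFree T (t * M)
    ≡⟨ ℕΣ.sumTo-cong (t * M) (λ k _ _ → split (does (t ∣? k)) _) ⟩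
  ℕΣ.sumTo (λ k → indicator (does (free? (t ∷ T) k)) + multiple k) (t * M)
    ≡⟨ ℕΣ.sumTo-∙ _ multiple (t * M) ⟩
  countFree (t ∷ T) (t * M) + ℕΣ.sumTo multiple (t * M)
    ≡⟨ cong (countFree (t ∷ T) (t * M) +_) (ℕΣ.sumTo-multiples _ t M) ⟩
  countFree (t ∷ T) (t * M) + ℕΣ.sumTo (λ j → indicator (does (free? T (t * j)))) M
    ≡⟨ cong (countFree (t ∷ T) (t * M) +_) (ℕΣ.sumTo-cong M λ j _ _ →
         cong indicator (does-⇔ (free-*ˡ j coprime) (free? T (t * j)) (free? T j))) ⟩
  countFree (t ∷ T) (t * M) + countFree T M
    ∎
  where
  multiple : ℕ → ℕ
  multiple k = if does (t ∣? k) then indicator (does (free? T k)) else 0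
  -- does (free? (t ∷ T) k) unfolds to not (does (t ∣? k)) ∧ does (free? T k).
  split : ∀ b g → indicator g ≡ indicator (not b ∧ g) + (if b then indicator g else 0)
  split false g = sym (+-identityʳ _)
  split true  g = refl

countFree-* : ∀ T M → AllPairs Coprime T → All (_∣ M) T →
  countFree T M * product T ≡ M * product (map pred T)
countFree-* [] M _ _ = *-identityʳ (countFree [] M) ⟨ trans ⟩ countAll M ⟨ trans ⟩ sym (*-identityʳ M)
  where
  countAll : ∀ M → countFree [] M ≡ M
  countAll zero    = refl
  countAll (suc M) = cong (_+ 1) (countAll M) ⟨ trans ⟩ +-comm M 1
-- A modulus 0 makes both sides vanish, because pred 0 = 0.
countFree-* (zero ∷ T) M _ _ = *-zeroʳ (countFree (0 ∷ T) M) ⟨ trans ⟩ sym (*-zeroʳ M)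
countFree-* (t@(suc u) ∷ T) M (t⊥T ∷ T-coprime) (divides M′ M≡M′*t ∷ T∣M)
  rewrite M≡M′*t | *-comm M′ t = begin
    X * (t * P)             ≡⟨ x*[y*z]≡y*[x*z] X t P ⟩
    t * (X * P)             ≡⟨ cong (t *_) X*P≡u*M′*P′ ⟩
    t * (u * M′ * P′)       ≡⟨ x*[y*z*w]≡x*z*[y*w] t u M′ P′ ⟩
    t * M′ * (u * P′)       ∎
  where
  x*[y*z]≡y*[x*z] : ∀ x y z → x * (y * z) ≡ y * (x * z)
  x*[y*z]≡y*[x*z] = solve-∀
  x*[y*z*w]≡x*z*[y*w] : ∀ x y z w → x * (y * z * w) ≡ x * z * (y * w)
  x*[y*z*w]≡x*z*[y*w] = solve-∀
  [1+x]*y*z≡x*y*z+y*z : ∀ x y z → suc x * y * z ≡ x * y * z + y * z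
  [1+x]*y*z≡x*y*z+y*z = solve-∀
  X  = countFree (t ∷ T) (t * M′)
  P  = product T
  P′ = product (map pred T)
  coprime : All (λ v → Coprime v t) T
  coprime = All.map Coprime.sym t⊥T
  T∣M′ : All (_∣ M′) T
  T∣M′ = All.zipWith {P = λ v → Coprime v t} (λ (v⊥t , v∣tM′) → coprime-divisor v⊥t v∣tM′) (coprime , T∣M)
  X*P≡u*M′*P′ : X * P ≡ u * M′ * P′
  X*P≡u*M′*P′ = +-cancelʳ-≡ (M′ * P′) _ _ (begin
    X * P + M′ * P′                    ≡⟨ cong (X * P +_) (sym (countFree-* T M′ T-coprime T∣M′)) ⟩
    X * P + countFree T M′ * P         ≡⟨ sym (*-distribʳ-+ P X _) ⟩
    (X + countFree T M′) * P           ≡⟨ cong (_* P) (sym (countFree-∷ t T M′ coprime)) ⟩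
    countFree T (t * M′) * P           ≡⟨ countFree-* T (t * M′) T-coprime T∣M ⟩
    t * M′ * P′                        ≡⟨ [1+x]*y*z≡x*y*z+y*z u M′ P′ ⟩
    u * M′ * P′ + M′ * P′              ∎)

prime≥2 : ∀ {p} → Prime p → 2 ≤ p
prime≥2 {p} p-prime = nonTrivial⇒n>1 p {{prime⇒nonTrivial p-prime}}

prime≥1 : ∀ {p} → Prime p → 1 ≤ p
prime≥1 p-prime = ≤-trans (s≤s z≤n) (prime≥2 p-prime)

∃prime∣ : ∀ n → 2 ≤ n → ∃[ p ] Prime p × p ∣ n
∃prime∣ n@(suc _) 2≤n with factorise n
... | record { factors = [] ; isFactorisation = n≡1 } = contradiction n≡1 (>⇒≢ 2≤n)
... | record { factors = p ∷ ps ; isFactorisation = n≡p*Πps ; factorsPrime = p-prime ∷ _ } =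
  p , p-prime , subst (p ∣_) (sym n≡p*Πps) (m∣m*n (product ps))

prime∣prime⇒≡ : ∀ {p q} → Prime p → Prime q → p ∣ q → p ≡ q
prime∣prime⇒≡ p-prime q-prime p∣q with prime⇒irreducible q-prime p∣q
... | inj₁ p≡1 = contradiction p≡1 (nonTrivial⇒≢1 {{prime⇒nonTrivial p-prime}})
... | inj₂ p≡q = p≡q

prime∣^⇒∣ : ∀ {p m} k → Prime p → p ∣ m ^ k → p ∣ m
prime∣^⇒∣ zero    p-prime p∣1 = contradiction (∣1⇒≡1 p∣1) (nonTrivial⇒≢1 {{prime⇒nonTrivial p-prime}})
prime∣^⇒∣ {m = m} (suc k) p-prime p∣m*m^k with euclidsLemma m (m ^ k) p-prime p∣m*m^k
... | inj₁ p∣m   = p∣m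
... | inj₂ p∣m^k = prime∣^⇒∣ k p-prime p∣m^k

coprime-if-no-common-prime : ∀ {m n} → m ≢ 0 → (∀ {p} → Prime p → p ∣ m → ¬ p ∣ n) → Coprime m n
coprime-if-no-common-prime m≢0 _         {zero}              (0∣m , _)   = contradiction (0∣⇒≡0 0∣m) m≢0
coprime-if-no-common-prime _   _         {suc zero}          _           = refl
coprime-if-no-common-prime _   no-common {i@(suc (suc _))} (i∣m , i∣n)
  with p , p-prime , p∣i ← ∃prime∣ i (s≤s (s≤s z≤n)) =
  contradiction (∣-trans p∣i i∣n) (no-common p-prime (∣-trans p∣i i∣m))

prime-powers-coprime : ∀ {p q} a b → Prime p → Prime q → p ≢ q → Coprime (p ^ a) (q ^ b)
prime-powers-coprime {p} a b p-prime q-prime p≢q =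
  coprime-if-no-common-prime (≢-nonZero⁻¹ _ {{m^n≢0 p a {{prime⇒nonZero p-prime}}}}) λ r-prime r∣p^a r∣q^b →
    p≢q (trans (sym (prime∣prime⇒≡ r-prime p-prime (prime∣^⇒∣ a r-prime r∣p^a)))
               (prime∣prime⇒≡ r-prime q-prime (prime∣^⇒∣ b r-prime r∣q^b)))

coprime-prime-power : ∀ {p m} a → Prime p → ¬ p ∣ m → m ≢ 0 → Coprime m (p ^ a)
coprime-prime-power a p-prime p∤m m≢0 = coprime-if-no-common-prime m≢0 λ r-prime r∣m r∣p^a →
  p∤m (subst (_∣ _) (prime∣prime⇒≡ r-prime p-prime (prime∣^⇒∣ a r-prime r∣p^a)) r∣m)

prime-power-decomposition : ∀ {p} → Prime p → ∀ n → 1 ≤ n → ∃[ a ] ∃[ m ] n ≡ p ^ a * m × ¬ p ∣ m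
prime-power-decomposition {p} p-prime = <-rec _ go
  where
  go : ∀ n → (∀ {k} → k < n → 1 ≤ k → ∃[ a ] ∃[ m ] k ≡ p ^ a * m × ¬ p ∣ m) →
       1 ≤ n → ∃[ a ] ∃[ m ] n ≡ p ^ a * m × ¬ p ∣ m
  go n rec 1≤n with p ∣? n
  ... | no  p∤n = 0 , n , sym (+-identityʳ n) , p∤n
  ... | yes p∣n
    with a , m , q≡p^a*m , p∤m ← rec (quotient-< p∣n {{prime⇒nonTrivial p-prime}} {{>-nonZero 1≤n}})
                                     (>-nonZero⁻¹ _ {{quotient≢0 p∣n {{>-nonZero 1≤n}}}}) =
    suc a , m , (m∣n⇒n≡m*quotient p∣n ⟨ trans ⟩ cong (p *_) q≡p^a*m ⟨ trans ⟩ sym (*-assoc p (p ^ a) m)) , p∤m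

∈-range1⁺ : ∀ {l n} → 1 ≤ l → l ≤ n → l ∈ range1 n
∈-range1⁺ {suc l} {suc n} _ (s≤s l≤n) = ∈-map⁺ suc (∈-upTo⁺ (s≤s l≤n))

foldr-⊔-upper : ∀ {x} xs → x ∈ xs → x ≤ foldr _⊔_ 0 xs
foldr-⊔-upper (y ∷ ys) (here refl) = m≤m⊔n y _
foldr-⊔-upper (y ∷ ys) (there x∈) = ≤-trans (foldr-⊔-upper ys x∈) (m≤n⊔m y _)

foldr-⊔-lub : ∀ {c} xs → All (_≤ c) xs → foldr _⊔_ 0 xs ≤ c
foldr-⊔-lub []       []               = z≤n
foldr-⊔-lub (y ∷ ys) (y≤c ∷ ys≤c) = ⊔-lub y≤c (foldr-⊔-lub ys ys≤c)

record PrimeDivisors (n : ℕ) (Q : List ℕ) : Set where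
  field
    primes   : All Prime Q
    distinct : Unique Q
    divide   : All (_∣ n) Q
    complete : ∀ {p} → Prime p → p ∣ n → p ∈ Q

primeDivisors : ℕ → List ℕ
primeDivisors n = filter (λ p → prime? p ×-dec p ∣? n) (range1 n)

primeDivisors-correct : ∀ {n} → 1 ≤ n → PrimeDivisors n (primeDivisors n)
primeDivisors-correct {n} 1≤n = record
  { primes   = All.map proj₁ (all-filter P? (range1 n))
  ; distinct = Unique.filter⁺ P? (Unique.map⁺ suc-injective (Unique.upTo⁺ n))
  ; divide   = All.map proj₂ (all-filter P? (range1 n))
  ; complete = λ p-prime p∣n → ∈-filter⁺ P? (∈-range1⁺ (prime≥1 p-prime) (∣⇒≤ {{>-nonZero 1≤n}} p∣n)) (p-prime , p∣n)
  }
  where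
  P? = λ p → prime? p ×-dec p ∣? n

PrimeDivisors-∷ : ∀ {p m Q} a → Prime p → ¬ p ∣ m → PrimeDivisors m Q → PrimeDivisors (p ^ suc a * m) (p ∷ Q)
PrimeDivisors-∷ {p} {m} {Q} a p-prime p∤m Q-pd = record
  { primes   = p-prime ∷ primes
  ; distinct = All.map (λ q∣m p≡q → p∤m (subst (_∣ m) (sym p≡q) q∣m)) divide ∷ distinct
  ; divide   = ∣m⇒∣m*n m (m∣m^n p {suc a} (s≤s z≤n)) ∷ All.map (∣n⇒∣m*n (p ^ suc a)) divide
  ; complete = complete′
  }
  where
  open PrimeDivisors Q-pd
  complete′ : ∀ {r} → Prime r → r ∣ p ^ suc a * m → r ∈ p ∷ Q
  complete′ r-prime r∣n with euclidsLemma (p ^ suc a) m r-prime r∣n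
  ... | inj₁ r∣p^a = here (prime∣prime⇒≡ r-prime p-prime (prime∣^⇒∣ (suc a) r-prime r∣p^a))
  ... | inj₂ r∣m   = there (complete r-prime r∣m)

HasSquareFactor : ℕ → Set
HasSquareFactor n = ∃[ k ] 2 ≤ k × k * k ∣ n

hasSquareFactor?⇔ : ∀ {n} → 1 ≤ n → Any (λ k → k * k ∣ n) (map (λ i → suc (suc i)) (upTo n)) ⇔ HasSquareFactor n
hasSquareFactor?⇔ {n} 1≤n = mk⇔ ⇒ ⇐
  where
  ⇒ : Any (λ k → k * k ∣ n) (map (λ i → suc (suc i)) (upTo n)) → HasSquareFactor n
  ⇒ any with i , kk∣n ← Any.satisfied (Any.map⁻ any) = suc (suc i) , s≤s (s≤s z≤n) , kk∣n
  ⇐ : HasSquareFactor n → Any (λ k → k * k ∣ n) (map (λ i → suc (suc i)) (upTo n))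
  ⇐ (k@(suc (suc i)) , s≤s (s≤s z≤n) , kk∣n) = Any.map⁺ (Any.map (λ { refl → kk∣n }) (∈-upTo⁺ i<n))
    where
    i<n : i < n
    i<n = ≤-trans (n≤1+n (suc i)) (≤-trans (m≤m*n k k) (∣⇒≤ {{>-nonZero 1≤n}} kk∣n))

μ*μ≡if-hasSquareFactor : ∀ n → μ n ℤ.* μ n ≡ (if does (hasSquareFactor? n) then ℤ.+ 0 else ℤ.+ 1)
μ*μ≡if-hasSquareFactor n with does (hasSquareFactor? n)
... | true  = refl
... | false = -1^k*-1^k≡1 (ω n)
  where
  -1^k*-1^k≡1 : ∀ k → (ℤ.- ℤ.+ 1) ℤ.^ k ℤ.* (ℤ.- ℤ.+ 1) ℤ.^ k ≡ ℤ.+ 1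
  -1^k*-1^k≡1 zero    = refl
  -1^k*-1^k≡1 (suc k) = trans (-x*-x≡x*x ((ℤ.- ℤ.+ 1) ℤ.^ k)) (-1^k*-1^k≡1 k)
    where
    -x*-x≡x*x : ∀ x → (ℤ.- ℤ.+ 1 ℤ.* x) ℤ.* (ℤ.- ℤ.+ 1 ℤ.* x) ≡ x ℤ.* x
    -x*-x≡x*x = ℤSolver.solve-∀

μ*μ-squareFactor : ∀ {n} → 1 ≤ n → HasSquareFactor n → μ n ℤ.* μ n ≡ ℤ.+ 0
μ*μ-squareFactor {n} 1≤n sq = trans (μ*μ≡if-hasSquareFactor n)
  (cong (if_then ℤ.+ 0 else ℤ.+ 1) (dec-true (hasSquareFactor? n) (Equivalence.from (hasSquareFactor?⇔ 1≤n) sq)))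

μ*μ-cong : ∀ {m n} → 1 ≤ m → 1 ≤ n → HasSquareFactor m ⇔ HasSquareFactor n → μ m ℤ.* μ m ≡ μ n ℤ.* μ n
μ*μ-cong {m} {n} 1≤m 1≤n m⇔n = trans (μ*μ≡if-hasSquareFactor m) (trans
  (cong (if_then ℤ.+ 0 else ℤ.+ 1) (does-⇔ (⇔-sym (hasSquareFactor?⇔ 1≤n) ⇔-∘ (m⇔n ⇔-∘ hasSquareFactor?⇔ 1≤m))
                                       (hasSquareFactor? m) (hasSquareFactor? n)))
  (sym (μ*μ≡if-hasSquareFactor n)))

squareFactor-*-prime⇔ : ∀ {p j} → Prime p → ¬ p ∣ j → HasSquareFactor (p * j) ⇔ HasSquareFactor j
squareFactor-*-prime⇔ {p} {j} p-prime p∤j = mk⇔ ⇒ ⇐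
  where
  ⇐ : HasSquareFactor j → HasSquareFactor (p * j)
  ⇐ (k , 2≤k , kk∣j) = k , 2≤k , ∣n⇒∣m*n p kk∣j
  ⇒ : HasSquareFactor (p * j) → HasSquareFactor j
  ⇒ (k , 2≤k , kk∣pj) with r , r-prime , r∣k ← ∃prime∣ k 2≤k | r ≟ p
  ... | yes refl = contradiction (*-cancelˡ-∣ r {{prime⇒nonZero r-prime}} rr∣pj) p∤j
    where rr∣pj = ∣-trans (*-pres-∣ r∣k r∣k) kk∣pj
  ... | no r≢p   = r , prime≥2 r-prime , coprime-divisor r*r⊥p (∣-trans (*-pres-∣ r∣k r∣k) kk∣pj)
    where
    r*r⊥p : Coprime (r * r) p
    r*r⊥p = subst₂ Coprime (cong (r *_) (*-identityʳ r)) (*-identityʳ p) (prime-powers-coprime 2 1 r-prime p-prime r≢p)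

module ℚΣ = RangeSum ℚ.+-0-isCommutativeMonoid

fromℚᵘ-homo-* : ∀ p q → fromℚᵘ p ℚ.* fromℚᵘ q ≡ fromℚᵘ (p ℚᵘ.* q)
fromℚᵘ-homo-* p q = toℚᵘ-injective (ℚᵘ.≃-trans (toℚᵘ-homo-* (fromℚᵘ p) (fromℚᵘ q))
  (ℚᵘ.≃-trans (ℚᵘ.*-cong (toℚᵘ-fromℚᵘ p) (toℚᵘ-fromℚᵘ q)) (ℚᵘ.≃-sym (toℚᵘ-fromℚᵘ (p ℚᵘ.* q)))))

fromℚᵘ-homo-+ : ∀ p q → fromℚᵘ p ℚ.+ fromℚᵘ q ≡ fromℚᵘ (p ℚᵘ.+ q)
fromℚᵘ-homo-+ p q = toℚᵘ-injective (ℚᵘ.≃-trans (toℚᵘ-homo-+ (fromℚᵘ p) (fromℚᵘ q))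
  (ℚᵘ.≃-trans (ℚᵘ.+-cong (toℚᵘ-fromℚᵘ p) (toℚᵘ-fromℚᵘ q)) (ℚᵘ.≃-sym (toℚᵘ-fromℚᵘ (p ℚᵘ.+ q)))))

-- For a nonzero denominator, x // suc b unfolds to fromℚᵘ (mkℚᵘ x b).
//-* : ∀ x y {a b} → 1 ≤ a → 1 ≤ b → (x // a) ℚ.* (y // b) ≡ (x ℤ.* y) // (a * b)
//-* x y {suc a} {suc b} _ _ = fromℚᵘ-homo-* (mkℚᵘ x a) (mkℚᵘ y b)

+//-cross : ∀ {a b c d} → 1 ≤ b → 1 ≤ d → a * d ≡ c * b → (ℤ.+ a) // b ≡ (ℤ.+ c) // d
+//-cross {a} {suc b} {c} {suc d} _ _ ad≡cb =
  fromℚᵘ-cong {mkℚᵘ (ℤ.+ a) b} {mkℚᵘ (ℤ.+ c) d}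
    (*≡* (sym (pos-* a (suc d)) ⟨ trans ⟩ cong ℤ.+_ ad≡cb ⟨ trans ⟩ pos-* c (suc b)))

0// : ∀ b → (ℤ.+ 0) // b ≡ 0ℚ
0// zero    = refl
0// (suc b) = ℚ.0/n≡0 (suc b)

1+1//t≡[1+t]//t : ∀ {t} → 1 ≤ t → 1ℚ ℚ.+ (ℤ.+ 1) // t ≡ (ℤ.+ suc t) // t
1+1//t≡[1+t]//t {t@(suc t-1)} _ = trans (fromℚᵘ-homo-+ (mkℚᵘ (ℤ.+ 1) 0) (mkℚᵘ (ℤ.+ 1) t-1))
  (fromℚᵘ-cong {mkℚᵘ (ℤ.+ 1) 0 ℚᵘ.+ mkℚᵘ (ℤ.+ 1) t-1} {mkℚᵘ (ℤ.+ suc t) t-1} (*≡* (cross (ℤ.+ t))))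
  where
  cross : ∀ u → (ℤ.+ 1 ℤ.* u ℤ.+ ℤ.+ 1 ℤ.* ℤ.+ 1) ℤ.* u ≡ (ℤ.+ 1 ℤ.+ u) ℤ.* (ℤ.+ 1 ℤ.* u)
  cross = ℤSolver.solve-∀

module _ {s : ℕ} (1≤s : 1 ≤ s) where

  common-power≤gcdPow : ∀ {a b} l → 1 ≤ a → l ^ s ∣ a → l ^ s ∣ b → l ^ s ≤ gcdPow s a b
  common-power≤gcdPow {a} {b} zero _ _ _ = subst (_≤ gcdPow s a b) (sym (0^n≡0 1≤s)) z≤n
  common-power≤gcdPow {a} {b} l@(suc _) 1≤a l^s∣a l^s∣b =
    foldr-⊔-upper _ (∈-map⁺ (_^ s)
      (∈-filter⁺ (λ l → (l ^ s ∣? a) ×-dec (l ^ s ∣? b)) (∈-range1⁺ (s≤s z≤n) l≤a+b) (l^s∣a , l^s∣b)))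
    where
    l≤a+b : l ≤ a + b
    l≤a+b = ≤-trans (m≤m^n (s≤s z≤n) 1≤s) (≤-trans (∣⇒≤ {{>-nonZero 1≤a}} l^s∣a) (m≤m+n a b))

  gcdPow≡1⇔ : ∀ {a} b → 1 ≤ a → gcdPow s a b ≡ 1 ⇔ (∀ l → 2 ≤ l → l ^ s ∣ a → ¬ l ^ s ∣ b)
  gcdPow≡1⇔ {a} b 1≤a = mk⇔ ⇒ ⇐
    where
    ⇒ : gcdPow s a b ≡ 1 → ∀ l → 2 ≤ l → l ^ s ∣ a → ¬ l ^ s ∣ b
    ⇒ gcd≡1 l 2≤l l^s∣a l^s∣b = <⇒≱ 2≤l (≤-trans (m≤m^n (≤-trans (s≤s z≤n) 2≤l) 1≤s)
                                                 (subst (l ^ s ≤_) gcd≡1 (common-power≤gcdPow l 1≤a l^s∣a l^s∣b)))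
    ⇐ : (∀ l → 2 ≤ l → l ^ s ∣ a → ¬ l ^ s ∣ b) → gcdPow s a b ≡ 1
    ⇐ no-common = ≤-antisym
      (foldr-⊔-lub _ (All.map⁺ (All.tabulate λ l∈ → atMost1 _ (proj₂ (∈-filter⁻ D? {xs = range1 (a + b)} l∈)))))
      (subst (_≤ gcdPow s a b) (^-zeroˡ s) (common-power≤gcdPow 1 1≤a (1^s∣ a) (1^s∣ b)))
      where
      D? = λ l → (l ^ s ∣? a) ×-dec (l ^ s ∣? b)
      1^s∣_ : ∀ k → 1 ^ s ∣ k
      1^s∣ k = subst (_∣ k) (sym (^-zeroˡ s)) (1∣ k)
      atMost1 : ∀ l → l ^ s ∣ a × l ^ s ∣ b → l ^ s ≤ 1
      atMost1 zero                _                = subst (_≤ 1) (sym (0^n≡0 1≤s)) z≤n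
      atMost1 (suc zero)          _                = ≤-reflexive (^-zeroˡ s)
      atMost1 l@(suc (suc _)) (l^s∣a , l^s∣b) = contradiction l^s∣b (no-common l (s≤s (s≤s z≤n)) l^s∣a)

  powers : List ℕ → List ℕ
  powers = map (_^ s)

  powers-coprime : ∀ {Q} → All Prime Q → Unique Q → AllPairs Coprime (powers Q)
  powers-coprime []                   []              = []
  powers-coprime {p ∷ Q} (p-prime ∷ Q-primes) (p∉Q ∷ Q-distinct) =
    All.map⁺ (All.zipWith {R = λ q → Coprime (p ^ s) (q ^ s)}
                          (λ (q-prime , p≢q) → prime-powers-coprime s s p-prime q-prime p≢q) (Q-primes , p∉Q))
    ∷ powers-coprime Q-primes Q-distinct

  noCommonPower⇔free : ∀ {n Q} k → PrimeDivisors n Q →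
    (∀ l → 2 ≤ l → l ^ s ∣ k → ¬ l ^ s ∣ n ^ s) ⇔ Free (powers Q) k
  noCommonPower⇔free {n} {Q} k Q-pd = mk⇔ ⇒ ⇐
    where
    open PrimeDivisors Q-pd
    ⇒ : (∀ l → 2 ≤ l → l ^ s ∣ k → ¬ l ^ s ∣ n ^ s) → Free (powers Q) k
    ⇒ no-common = All.map⁺ (All.zipWith (λ (p-prime , p∣n) p^s∣k → no-common _ (prime≥2 p-prime) p^s∣k (^-mono-∣ s p∣n))
                                        (primes , divide))
    ⇐ : Free (powers Q) k → ∀ l → 2 ≤ l → l ^ s ∣ k → ¬ l ^ s ∣ n ^ s
    ⇐ free l 2≤l l^s∣k l^s∣n^s with r , r-prime , r∣l ← ∃prime∣ l 2≤l =
      All.lookup (All.map⁻ free) (complete r-prime r∣n) (∣-trans (^-mono-∣ s r∣l) l^s∣k)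
      where
      r∣n : r ∣ n
      r∣n = prime∣^⇒∣ s r-prime (∣-trans (m∣m^n r 1≤s) (∣-trans (^-mono-∣ s r∣l) l^s∣n^s))

  Φ≡countFree : ∀ {n Q} → PrimeDivisors n Q → Φ s (n ^ s) ≡ countFree (powers Q) (n ^ s)
  Φ≡countFree {n} {Q} Q-pd = begin
    length (filter G? (range1 N))                         ≡⟨ length≡count1 (filter G? (range1 N)) ⟩
    foldr _+_ 0 (map (λ _ → 1) (filter G? (range1 N)))    ≡⟨ ℕΣ.foldr-map-filter G? (λ _ → 1) (range1 N) ⟩
    foldr _+_ 0 (map (indicator ∘ does ∘ G?) (range1 N))  ≡⟨ ℕΣ.foldr-map-range1 _ N ⟩
    ℕΣ.sumTo (indicator ∘ does ∘ G?) N
      ≡⟨ ℕΣ.sumTo-cong N (λ k 1≤k _ →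
           cong indicator (does-⇔ (noCommonPower⇔free k Q-pd ⇔-∘ gcdPow≡1⇔ N 1≤k) (G? k) (free? _ k))) ⟩
    countFree (powers Q) N                               ∎
    where
    N = n ^ s
    G? = λ k → gcdPow s k N ≟ 1
    length≡count1 : ∀ (xs : List ℕ) → length xs ≡ foldr _+_ 0 (map (λ _ → 1) xs)
    length≡count1 []       = refl
    length≡count1 (x ∷ xs) = cong suc (length≡count1 xs)

  Φ-pow-* : ∀ {n Q} → PrimeDivisors n Q →
    Φ s (n ^ s) * product (powers Q) ≡ n ^ s * product (map pred (powers Q))
  Φ-pow-* {n} {Q} Q-pd = trans (cong (_* product (powers Q)) (Φ≡countFree Q-pd))
    (countFree-* (powers Q) (n ^ s) (powers-coprime primes distinct) (All.map⁺ (All.map (^-mono-∣ s) divide)))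
    where open PrimeDivisors Q-pd

  prime^s≥2 : ∀ {p} → Prime p → 2 ≤ p ^ s
  prime^s≥2 p-prime = ≤-trans (prime≥2 p-prime) (m≤m^n (prime≥1 p-prime) 1≤s)

  product-powers≥1 : ∀ {Q} → All Prime Q → 1 ≤ product (powers Q)
  product-powers≥1 Q-primes = product≥1 (All.map⁺ (All.map (λ p-prime → ≤-trans (s≤s z≤n) (prime^s≥2 p-prime)) Q-primes))

  product-pred-powers≥1 : ∀ {Q} → All Prime Q → 1 ≤ product (map pred (powers Q))
  product-pred-powers≥1 Q-primes = product≥1 (All.map⁺ (All.map⁺ (All.map (λ p-prime → ∸-monoˡ-≤ 1 (prime^s≥2 p-prime)) Q-primes)))

  Φ-pow≥1 : ∀ {n} → 1 ≤ n → 1 ≤ Φ s (n ^ s)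
  Φ-pow≥1 {n} 1≤n with Φ s (n ^ s) | Φ-pow-* (primeDivisors-correct 1≤n)
  ... | suc _ | _        = s≤s z≤n
  ... | zero  | 0≡n^s*P′ = contradiction 0≡n^s*P′ (<⇒≢ (*-mono-≤ (m^n>0 n {{>-nonZero 1≤n}} s) (product-pred-powers≥1 primes)))
    where open PrimeDivisors (primeDivisors-correct 1≤n)

  Φ-pow-*-prime : ∀ {p j} → Prime p → ¬ p ∣ j → 1 ≤ j → Φ s ((p * j) ^ s) ≡ Φ s (j ^ s) * pred (p ^ s)
  Φ-pow-*-prime {p} {j} p-prime p∤j 1≤j = *-cancelʳ-≡ _ _ (T * P) {{>-nonZero 1≤T*P}} (begin
    Φ s ((p * j) ^ s) * (T * P)        ≡⟨ Φ-pow-* pj-pd ⟩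
    (p * j) ^ s * (pred T * P′)        ≡⟨ cong (_* (pred T * P′)) (^-distribʳ-* p j s) ⟩
    T * j ^ s * (pred T * P′)          ≡⟨ x*y*[z*w]≡x*z*[y*w] T (j ^ s) (pred T) P′ ⟩
    T * pred T * (j ^ s * P′)          ≡⟨ cong (T * pred T *_) (sym (Φ-pow-* Q-pd)) ⟩
    T * pred T * (Φ s (j ^ s) * P)     ≡⟨ x*y*[z*w]≡z*y*[x*w] T (pred T) (Φ s (j ^ s)) P ⟩
    Φ s (j ^ s) * pred T * (T * P)     ∎)
    where
    Q-pd = primeDivisors-correct 1≤j
    T  = p ^ s
    P  = product (powers (primeDivisors j))
    P′ = product (map pred (powers (primeDivisors j)))
    pj-pd : PrimeDivisors (p * j) (p ∷ primeDivisors j)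
    pj-pd = subst (λ n → PrimeDivisors n (p ∷ primeDivisors j)) (cong (_* j) (*-identityʳ p)) (PrimeDivisors-∷ 0 p-prime p∤j Q-pd)
    1≤T*P : 1 ≤ T * P
    1≤T*P = *-mono-≤ (≤-trans (s≤s z≤n) (prime^s≥2 p-prime)) (product-powers≥1 (PrimeDivisors.primes Q-pd))
    x*y*[z*w]≡x*z*[y*w] : ∀ x y z w → x * y * (z * w) ≡ x * z * (y * w)
    x*y*[z*w]≡x*z*[y*w] = solve-∀
    x*y*[z*w]≡z*y*[x*w] : ∀ x y z w → x * y * (z * w) ≡ z * y * (x * w)
    x*y*[z*w]≡z*y*[x*w] = solve-∀

  kleeRatio : ℕ → ℚ
  kleeRatio n = (ℤ.+ (n ^ s)) // Φ s (n ^ s)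

  kleeRatio-primeDivisors : ∀ {n Q} → 1 ≤ n → PrimeDivisors n Q →
    kleeRatio n ≡ (ℤ.+ product (powers Q)) // product (map pred (powers Q))
  kleeRatio-primeDivisors {n} {Q} 1≤n Q-pd = +//-cross (Φ-pow≥1 1≤n) (product-pred-powers≥1 (PrimeDivisors.primes Q-pd))
    (sym (Φ-pow-* Q-pd) ⟨ trans ⟩ *-comm (Φ s (n ^ s)) _)

  kleeRatio-prime-power : ∀ {p m} a → Prime p → ¬ p ∣ m → 1 ≤ m →
    kleeRatio (p ^ suc a * m) ≡ ((ℤ.+ (p ^ s)) // pred (p ^ s)) ℚ.* kleeRatio m
  kleeRatio-prime-power {p} {m} a p-prime p∤m 1≤m = begin
    kleeRatio (p ^ suc a * m)                          ≡⟨ kleeRatio-primeDivisors 1≤n (PrimeDivisors-∷ a p-prime p∤m Q-pd) ⟩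
    (ℤ.+ (T * P)) // (pred T * P′)                     ≡⟨ cong (_// (pred T * P′)) (pos-* T P) ⟩
    (ℤ.+ T ℤ.* ℤ.+ P) // (pred T * P′)
      ≡⟨ sym (//-* (ℤ.+ T) (ℤ.+ P) 1≤pred[T] (product-pred-powers≥1 Q-primes)) ⟩
    ((ℤ.+ T) // pred T) ℚ.* ((ℤ.+ P) // P′)
      ≡⟨ cong (((ℤ.+ T) // pred T) ℚ.*_) (sym (kleeRatio-primeDivisors 1≤m Q-pd)) ⟩
    ((ℤ.+ T) // pred T) ℚ.* kleeRatio m                ∎
    where
    Q-pd = primeDivisors-correct 1≤m
    Q-primes = PrimeDivisors.primes Q-pd
    T  = p ^ s
    P  = product (powers (primeDivisors m))
    P′ = product (map pred (powers (primeDivisors m)))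
    1≤pred[T] : 1 ≤ pred T
    1≤pred[T] = ∸-monoˡ-≤ 1 (prime^s≥2 p-prime)
    1≤n : 1 ≤ p ^ suc a * m
    1≤n = *-mono-≤ (m^n>0 p {{prime⇒nonZero p-prime}} (suc a)) 1≤m

  divisorTerm : ℕ → ℚ
  divisorTerm d = (μ d ℤ.* μ d) // Φ s (d ^ s)

  divisorSum : ℕ → ℚ
  divisorSum n = Σℚ (map divisorTerm (divisors n))

  divisorSummand : ℕ → ℕ → ℚ
  divisorSummand n d = if does (d ∣? n) then divisorTerm d else 0ℚ

  divisorSum≡sumTo : ∀ n → divisorSum n ≡ ℚΣ.sumTo (divisorSummand n) n
  divisorSum≡sumTo n = trans (ℚΣ.foldr-map-filter (_∣? n) divisorTerm (range1 n)) (ℚΣ.foldr-map-range1 (divisorSummand n) n)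

  sumTo-divisorSummand : ∀ {m n} → 1 ≤ m → m ≤ n → ℚΣ.sumTo (divisorSummand m) n ≡ divisorSum m
  sumTo-divisorSummand {m} 1≤m m≤n = trans (ℚΣ.sumTo-extend (divisorSummand m) beyond m≤n) (sym (divisorSum≡sumTo m))
    where
    beyond : ∀ d → m < d → divisorSummand m d ≡ 0ℚ
    beyond d m<d = cong (if_then divisorTerm d else 0ℚ) (dec-false (d ∣? m) λ d∣m → <⇒≱ m<d (∣⇒≤ {{>-nonZero 1≤m}} d∣m))

  divisorTerm-*-prime : ∀ {p j} → Prime p → ¬ p ∣ j → 1 ≤ j →
    divisorTerm (p * j) ≡ divisorTerm j ℚ.* ((ℤ.+ 1) // pred (p ^ s))
  divisorTerm-*-prime {p} {j} p-prime p∤j 1≤j = begin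
    (μ (p * j) ℤ.* μ (p * j)) // Φ s ((p * j) ^ s)  ≡⟨ cong₂ _//_ μ²-pj≡μ²-j (Φ-pow-*-prime p-prime p∤j 1≤j) ⟩
    (μ j ℤ.* μ j) // (Φ s (j ^ s) * pred T)          ≡⟨ cong (_// (Φ s (j ^ s) * pred T)) (sym (ℤ.*-identityʳ (μ j ℤ.* μ j))) ⟩
    (μ j ℤ.* μ j ℤ.* ℤ.+ 1) // (Φ s (j ^ s) * pred T) ≡⟨ sym (//-* _ _ (Φ-pow≥1 1≤j) (∸-monoˡ-≤ 1 (prime^s≥2 p-prime))) ⟩
    divisorTerm j ℚ.* ((ℤ.+ 1) // pred T)            ∎
    where
    T = p ^ s
    μ²-pj≡μ²-j = μ*μ-cong (*-mono-≤ (prime≥1 p-prime) 1≤j) 1≤j (squareFactor-*-prime⇔ p-prime p∤j)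

  module PrimePowerStep {p m : ℕ} (a : ℕ) (p-prime : Prime p) (p∤m : ¬ p ∣ m) (1≤m : 1 ≤ m) where

    n t : ℕ
    n = p ^ suc a * m
    t = p ^ a * m

    n≡p*t : n ≡ p * t
    n≡p*t = *-assoc p (p ^ a) m

    c : ℚ
    c = (ℤ.+ 1) // pred (p ^ s)

    m≤t : m ≤ t
    m≤t = m≤n*m m (p ^ a) {{m^n≢0 p a {{prime⇒nonZero p-prime}}}}

    m<n : m < n
    m<n = subst (m <_) (sym n≡p*t) (<-≤-trans m<p*m (*-monoʳ-≤ p m≤t))
      where
      m<p*m : m < p * m
      m<p*m = subst (m <_) (*-comm m p) (m<m*n m p {{>-nonZero 1≤m}} (prime≥2 p-prime))

    summand-p∤ : ∀ d → ¬ p ∣ d → divisorSummand n d ≡ divisorSummand m d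
    summand-p∤ d p∤d = cong (if_then divisorTerm d else 0ℚ) (does-⇔ d∣n⇔d∣m (d ∣? n) (d ∣? m))
      where
      d∣n⇔d∣m : d ∣ n ⇔ d ∣ m
      d∣n⇔d∣m = mk⇔ (coprime-divisor (coprime-prime-power (suc a) p-prime p∤d λ { refl → p∤d (p ∣0) }))
                    (λ d∣m → ∣-trans d∣m (n∣m*n (p ^ suc a)))

    summand-p∣ : ∀ d → p ∣ d → divisorSummand m d ≡ 0ℚ
    summand-p∣ d p∣d = cong (if_then divisorTerm d else 0ℚ) (dec-false (d ∣? m) λ d∣m → p∤m (∣-trans p∣d d∣m))

    summand-p* : ∀ j → 1 ≤ j → divisorSummand n (p * j) ≡ divisorSummand m j ℚ.* c
    summand-p* j 1≤j with p ∣? j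
    ... | yes p∣j = trans (cong (λ x → if does (p * j ∣? n) then x else 0ℚ) term≡0 ⟨ trans ⟩ if-eta (does (p * j ∣? n)))
                          (sym (cong (ℚ._* c) (summand-p∣ j p∣j) ⟨ trans ⟩ ℚ.*-zeroˡ c))
      where
      term≡0 : divisorTerm (p * j) ≡ 0ℚ
      term≡0 = trans (cong (_// Φ s ((p * j) ^ s)) (μ*μ-squareFactor (*-mono-≤ (prime≥1 p-prime) 1≤j) p²∣pj))
                     (0// (Φ s ((p * j) ^ s)))
        where
        p²∣pj : HasSquareFactor (p * j)
        p²∣pj = p , prime≥2 p-prime , *-monoʳ-∣ p p∣j
    ... | no p∤j = begin
      (if does (p * j ∣? n) then divisorTerm (p * j) else 0ℚ)
        ≡⟨ cong (if_then divisorTerm (p * j) else 0ℚ) (does-⇔ pj∣n⇔j∣m (p * j ∣? n) (j ∣? m)) ⟩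
      (if does (j ∣? m) then divisorTerm (p * j) else 0ℚ)
        ≡⟨ cong₂ (if does (j ∣? m) then_else_) (divisorTerm-*-prime p-prime p∤j 1≤j) (sym (ℚ.*-zeroˡ c)) ⟩
      (if does (j ∣? m) then divisorTerm j ℚ.* c else 0ℚ ℚ.* c) ≡⟨ sym (if-float (ℚ._* c) (does (j ∣? m))) ⟩
      divisorSummand m j ℚ.* c                                  ∎
      where
      pj∣n⇔j∣m : p * j ∣ n ⇔ j ∣ m
      pj∣n⇔j∣m = mk⇔
        (λ pj∣n → coprime-divisor (coprime-prime-power a p-prime p∤j λ { refl → p∤j (p ∣0) })
                                  (*-cancelˡ-∣ p {{prime⇒nonZero p-prime}} (subst (p * j ∣_) n≡p*t pj∣n)))
        (λ j∣m → subst (p * j ∣_) (sym n≡p*t) (*-monoʳ-∣ p (∣n⇒∣m*n (p ^ a) j∣m)))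

    divisorSum-prime-power : divisorSum n ≡ divisorSum m ℚ.+ divisorSum m ℚ.* c
    divisorSum-prime-power = begin
      divisorSum n                                          ≡⟨ divisorSum≡sumTo n ⟩
      ℚΣ.sumTo (divisorSummand n) n                         ≡⟨ ℚΣ.sumTo-cong n (λ d _ _ → split (does (p ∣? d)) _) ⟩
      ℚΣ.sumTo (λ d → coprimePart d ℚ.+ multiplePart d) n  ≡⟨ ℚΣ.sumTo-∙ coprimePart multiplePart n ⟩
      ℚΣ.sumTo coprimePart n ℚ.+ ℚΣ.sumTo multiplePart n   ≡⟨ cong₂ ℚ._+_ coprimeSum multipleSum ⟩
      divisorSum m ℚ.+ divisorSum m ℚ.* c                   ∎
      where
      coprimePart multiplePart : ℕ → ℚ
      coprimePart  d = if does (p ∣? d) then 0ℚ else divisorSummand n d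
      multiplePart d = if does (p ∣? d) then divisorSummand n d else 0ℚ
      split : ∀ b x → x ≡ (if b then 0ℚ else x) ℚ.+ (if b then x else 0ℚ)
      split false x = sym (ℚ.+-identityʳ x)
      split true  x = sym (ℚ.+-identityˡ x)
      coprimePart≡ : ∀ d → coprimePart d ≡ divisorSummand m d
      coprimePart≡ d with p ∣? d
      ... | yes p∣d = sym (summand-p∣ d p∣d)
      ... | no  p∤d = summand-p∤ d p∤d
      coprimeSum : ℚΣ.sumTo coprimePart n ≡ divisorSum m
      coprimeSum = trans (ℚΣ.sumTo-cong n λ d _ _ → coprimePart≡ d) (sumTo-divisorSummand 1≤m (<⇒≤ m<n))
      multipleSum : ℚΣ.sumTo multiplePart n ≡ divisorSum m ℚ.* c
      multipleSum = begin
        ℚΣ.sumTo multiplePart n                       ≡⟨ cong (ℚΣ.sumTo multiplePart) n≡p*t ⟩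
        ℚΣ.sumTo multiplePart (p * t)                 ≡⟨ ℚΣ.sumTo-multiples (divisorSummand n) p {{prime⇒nonZero p-prime}} t ⟩
        ℚΣ.sumTo (λ j → divisorSummand n (p * j)) t   ≡⟨ ℚΣ.sumTo-cong t (λ j 1≤j _ → summand-p* j 1≤j) ⟩
        ℚΣ.sumTo (λ j → divisorSummand m j ℚ.* c) t
          ≡⟨ ℚΣ.sumTo-homo (ℚ._* c) (ℚ.*-zeroˡ c) (ℚ.*-distribʳ-+ c) (divisorSummand m) t ⟩
        ℚΣ.sumTo (divisorSummand m) t ℚ.* c           ≡⟨ cong (ℚ._* c) (sumTo-divisorSummand 1≤m m≤t) ⟩
        divisorSum m ℚ.* c                            ∎

    step : kleeRatio m ≡ divisorSum m → kleeRatio n ≡ divisorSum n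
    step kleeRatio-m = begin
      kleeRatio n                                  ≡⟨ kleeRatio-prime-power a p-prime p∤m 1≤m ⟩
      K ℚ.* kleeRatio m                            ≡⟨ cong₂ ℚ._*_ (sym 1+c≡K) kleeRatio-m ⟩
      (1ℚ ℚ.+ c) ℚ.* divisorSum m                  ≡⟨ ℚ.*-distribʳ-+ (divisorSum m) 1ℚ c ⟩
      1ℚ ℚ.* divisorSum m ℚ.+ c ℚ.* divisorSum m   ≡⟨ cong₂ ℚ._+_ (ℚ.*-identityˡ (divisorSum m)) (ℚ.*-comm c (divisorSum m)) ⟩
      divisorSum m ℚ.+ divisorSum m ℚ.* c          ≡⟨ sym divisorSum-prime-power ⟩
      divisorSum n                                 ∎
      where
      K = (ℤ.+ (p ^ s)) // pred (p ^ s)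
      1+c≡K : 1ℚ ℚ.+ c ≡ K
      1+c≡K = trans (1+1//t≡[1+t]//t (∸-monoˡ-≤ 1 (prime^s≥2 p-prime)))
                    (cong (λ x → (ℤ.+ x) // pred (p ^ s)) (suc-pred (p ^ s) {{m^n≢0 p s {{prime⇒nonZero p-prime}}}}))

  kleeRatio≡divisorSum : ∀ n → 1 ≤ n → kleeRatio n ≡ divisorSum n
  kleeRatio≡divisorSum = <-rec _ go
    where
    go : ∀ n → (∀ {m} → m < n → 1 ≤ m → kleeRatio m ≡ divisorSum m) → 1 ≤ n → kleeRatio n ≡ divisorSum n
    -- divisorSum 1 evaluates to (μ 1 ℤ.* μ 1) // Φ s (1 ^ s) ℚ.+ 0ℚ, and μ 1 ℤ.* μ 1 to ℤ.+ 1.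
    go 1 _ _ = trans (cong (λ x → (ℤ.+ x) // Φ s (1 ^ s)) (^-zeroˡ s)) (sym (ℚ.+-identityʳ _))
    go n@(suc (suc _)) rec _ with p , p-prime , p∣n ← ∃prime∣ n (s≤s (s≤s z≤n))
      with prime-power-decomposition p-prime n (s≤s z≤n)
    ... | zero  , m , n≡m , p∤m = contradiction (subst (p ∣_) (n≡m ⟨ trans ⟩ *-identityˡ m) p∣n) p∤m
    ... | suc a , zero , n≡0 , _ = contradiction (n≡0 ⟨ trans ⟩ *-zeroʳ (p ^ suc a)) λ ()
    ... | suc a , m@(suc _) , n≡ , p∤m =
      subst (λ n → kleeRatio n ≡ divisorSum n) (sym n≡) (step (rec (subst (m <_) (sym n≡) m<n) (s≤s z≤n)))
      where open PrimePowerStep a p-prime p∤m (s≤s z≤n)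

lemma3p1 : (n s : ℕ) → 1 ≤ n → 1 ≤ s →
    (ℤ.+ (n ^ s)) // Φ s (n ^ s)
      ≡ Σℚ (map (λ d → (μ d ℤ.* μ d) // Φ s (d ^ s)) (divisors n))
lemma3p1 n s 1≤n 1≤s = kleeRatio≡divisorSum 1≤s n 1≤n
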